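{- Let $\mathbb F$ be a field, $\mathsf P$ a set of polynomials over $\mathbb F$, and $d\in\mathbb N$. If $\operatorname{MLIN}(\mathsf P^d)$ has a solution $\alpha$ over $\mathbb F$ that additionally satisfies $\alpha(X_\pi)=0\Rightarrow\alpha(X_\rho)=0$ for all index sets $\pi\subseteq\rho$, then $\mathsf P$ has no degree-$d$ monomial-PC refutation.
   Context: $\mathsf P^r$ is the set of all polynomials of degree at most $r$ obtained by multiplying a polynomial of $\mathsf P$ by a monomial (including $1$). $\operatorname{MLIN}(\mathsf P)$ is the system of linear equations obtained by replacing each monomial $x_{i_1}\cdots x_{i_\ell}$ by a new variable $X_{\{i_1,\dots,i_\ell\}}$ (indexed by the set of indices occurring, so $x_i^2$ becomes $X_{\{i\}}$), constants being kept, and setting each resulting polynomial equal to $0$. Polynomial calculus (PC) over $\mathbb F$: a derivation from $\mathsf P$ is a sequence of polynomials each of which is an axiom (an element of $\mathsf P$, or $x^2-x$ for a variable $x$), or obtained from an earlier $f$ by multiplication ($xf$ for a variable $x$), or from earlier $g,f$ by linear combination ($ag+bf$, $a,b\in\mathbb F$). A refutation is a derivation of $1$; the degree is the maximum degree of a polynomial in the derivation. A monomial-PC derivation is a PC derivation in which every application of the multiplication rule $f\mapsto xf$ has $f$ either a monomial or the product of a monomial and an axiom. -}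

module Defs where

open import Level using (Level; _⊔_; suc)
open import Data.Nat as ℕ using (ℕ; zero)
open import Data.Bool using (Bool; true; false; not)
open import Data.Product using (Σ; ∃; _×_; _,_)
open import Data.List as List using (List; []; _∷_; _++_)
open import Data.Vec as Vec using (Vec)
open import Data.Fin using (Fin)
open import Data.Fin.Subset using (Subset)
open import Relation.Nullary using (¬_; yes; no)
open import Relation.Binary.PropositionalEquality using (_≡_)
open import Algebra.Bundles using (CommutativeRing)
import Data.Vec.Properties as VecP

record Field (c ℓ : Level) : Set (Level.suc (c ⊔ ℓ)) where
  field
    commutativeRing : CommutativeRing c ℓ
  open CommutativeRing commutativeRing public
  field
    1≉0     : ¬ (1# ≈ 0#)
    inverse : ∀ x → ¬ (x ≈ 0#) → ∃ λ y → x * y ≈ 1#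

module PC {c ℓ : Level} (F : Field c ℓ) (n : ℕ) where
  open Field F

  -- A monomial x_0^{e_0} ⋯ x_{n-1}^{e_{n-1}} is its exponent vector.
  Monomial : Set
  Monomial = Vec ℕ n

  degM : Monomial → ℕ
  degM = Vec.foldr _ ℕ._+_ 0

  oneM : Monomial
  oneM = Vec.replicate n 0

  _·M_ : Monomial → Monomial → Monomial
  _·M_ = Vec.zipWith ℕ._+_

  varM : Fin n → Monomial
  varM i = Vec.updateAt oneM i (λ _ → 1)

  -- A polynomial is given by a finite list of terms (coefficient, monomial);
  -- its meaning is the sum of the terms.  Equality, degree, etc. are all
  -- defined semantically through the coefficient function.
  Poly : Set c
  Poly = List (Carrier × Monomial)

  coeff : Poly → Monomial → Carrier
  coeff []            μ = 0#
  coeff ((a , ν) ∷ t) μ with VecP.≡-dec ℕ._≟_ ν μ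
  ... | yes _ = a + coeff t μ
  ... | no  _ = coeff t μ

  _≈P_ : Poly → Poly → Set ℓ
  f ≈P g = ∀ μ → coeff f μ ≈ coeff g μ

  DegLe : ℕ → Poly → Set ℓ
  DegLe r f = ∀ μ → r ℕ.< degM μ → coeff f μ ≈ 0#

  monoP : Monomial → Poly
  monoP μ = (1# , μ) ∷ []

  oneP : Poly
  oneP = monoP oneM

  scale : Carrier → Poly → Poly
  scale a = List.map (λ { (b , μ) → (a * b , μ) })

  lin : Carrier → Poly → Carrier → Poly → Poly
  lin a g b f = scale a g ++ scale b f

  mulM : Monomial → Poly → Poly
  mulM μ = List.map (λ { (b , ν) → (b , μ ·M ν) })

  mulVar : Fin n → Poly → Poly
  mulVar i = mulM (varM i)

  boolAx : Fin n → Poly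
  boolAx i = (1# , varM i ·M varM i) ∷ (- 1# , varM i) ∷ []

  data Axiom {p : Level} (P : Poly → Set p) : Poly → Set (c ⊔ p) where
    fromP : ∀ {f} → P f → Axiom P f
    bool  : ∀ i → Axiom P (boolAx i)

  MonomialOrMonomialTimesAxiom : {p : Level} (P : Poly → Set p) → Poly → Set (c ⊔ ℓ ⊔ p)
  MonomialOrMonomialTimesAxiom P f =
    (∃ λ μ → f ≈P monoP μ) Data.Sum.⊎
    (∃ λ μ → ∃ λ a → Axiom P a × f ≈P mulM μ a)
    where import Data.Sum

  data MonoDeriv {p : Level} (P : Poly → Set p) (d : ℕ) : Poly → Set (c ⊔ ℓ ⊔ p) where
    axiom : ∀ {f} → Axiom P f → DegLe d f → MonoDeriv P d f
    mult  : ∀ {f} (i : Fin n) → MonoDeriv P d f →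
            MonomialOrMonomialTimesAxiom P f →
            DegLe d (mulVar i f) → MonoDeriv P d (mulVar i f)
    lincomb : ∀ {g f} (a b : Carrier) → MonoDeriv P d g → MonoDeriv P d f →
              DegLe d (lin a g b f) → MonoDeriv P d (lin a g b f)

  MonoRefutation : {p : Level} (P : Poly → Set p) (d : ℕ) → Set (c ⊔ ℓ ⊔ p)
  MonoRefutation P d = ∃ λ f → MonoDeriv P d f × f ≈P oneP

  -- Assignment to the variables X_π, π a (nonempty) set of indices.
  Assignment : Set c
  Assignment = Subset n → Carrier

  supp : Monomial → Subset n
  supp = Vec.map (λ { zero → false ; (ℕ.suc _) → true })

  -- value of the linearized monomial: constants kept (the empty monomial
  -- is the constant 1), otherwise X_{supp μ}.
  evalM : Assignment → Monomial → Carrier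
  evalM α μ with degM μ
  ... | zero    = 1#
  ... | ℕ.suc _ = α (supp μ)

  evalLin : Assignment → Poly → Carrier
  evalLin α []            = 0#
  evalLin α ((a , μ) ∷ t) = a * evalM α μ + evalLin α t

  -- P^r : polynomials μ·p with p ∈ P and deg(μ·p) ≤ r.
  -- α solves MLIN(P^r): every equation MLIN(q) = 0 holds for q ∈ P^r.
  SolvesMLIN : {p : Level} (P : Poly → Set p) (r : ℕ) → Assignment → Set (c ⊔ ℓ ⊔ p)
  SolvesMLIN P r α = ∀ f μ → P f → DegLe r (mulM μ f) → evalLin α (mulM μ f) ≈ 0#

  -- α(X_π) = 0 ⇒ α(X_ρ) = 0 for all index sets π ⊆ ρ (π nonempty, as X_∅
  -- is not a variable of MLIN).
  ZeroUpwardClosed : Assignment → Set ℓ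
  ZeroUpwardClosed α = ∀ (π ρ : Subset n) → Data.Fin.Subset.Nonempty π →
    π Data.Fin.Subset.⊆ ρ → α π ≈ 0# → α ρ ≈ 0#

-- A solution α of MLIN(P^d) induces a linear functional L on polynomials: a
-- monomial μ is sent to 1 if it is constant and to α(X_{supp μ}) otherwise.
-- Every line of a degree-d monomial-PC derivation lies in the kernel of L.
-- Multiples of P of degree ≤ d are there because α solves MLIN(P^d), and
-- multiples ν(x² - x) of Boolean axioms because ν x² and ν x have the same
-- support.  L is linear, so linear combinations stay in the kernel.  A
-- multiplication x·f with f a monomial times an axiom is again such a
-- multiple; with f a monomial μ, L μ = 0 forces μ to be nonconstant and
-- α(X_{supp μ}) = 0, hence α(X_{supp xμ}) = 0 by upward closure of the zeros
-- of α.  Since L 1 = 1 ≠ 0, the polynomial 1 is not derivable.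
module Submission where

open import Defs
open import Level using (Level)
open import Data.Nat using (ℕ; zero; suc)
import Data.Nat.Properties as ℕP
open import Data.Bool using (Bool; true; false; _∨_)
open import Data.Product using (_,_)
open import Data.List using ([]; _∷_; _++_)
open import Data.Vec as Vec using (Vec; []; _∷_)
import Data.Vec.Properties as VecP
open import Data.Fin using (Fin)
open import Data.Fin.Subset using (Subset; _∪_; _⊆_; Nonempty)
open import Data.Fin.Subset.Properties using (∪-idem; q⊆p∪q)
open import Data.Sum using (inj₁; inj₂)
open import Data.Empty using (⊥-elim)
open import Relation.Nullary using (¬_; yes; no)
open import Function using (_∘_)
import Relation.Binary.PropositionalEquality as ≡
open ≡ using (_≡_; _≢_)
open import Algebra.Properties.CommutativeSemigroup ℕP.+-commutativeSemigroup
  using (interchange)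

module ExponentVector where
  open import Data.Nat using (_+_)
  open ≡ using (refl; trans; cong; cong₂)

  private variable m : ℕ

  positive : ℕ → Bool
  positive zero    = false
  positive (suc _) = true

  support : Vec ℕ m → Subset m
  support = Vec.map positive

  sum-zipWith-+ : (u v : Vec ℕ m) →
                  Vec.sum (Vec.zipWith _+_ u v) ≡ Vec.sum u + Vec.sum v
  sum-zipWith-+ []      []      = refl
  sum-zipWith-+ (x ∷ u) (y ∷ v) =
    trans (cong (x + y +_) (sum-zipWith-+ u v)) (interchange x y _ _)

  sum-replicate-0 : ∀ m → Vec.sum (Vec.replicate m 0) ≡ 0
  sum-replicate-0 zero    = refl
  sum-replicate-0 (suc m) = sum-replicate-0 m

  sum-unitVector : (i : Fin m) →
                   Vec.sum (Vec.updateAt (Vec.replicate m 0) i (λ _ → 1)) ≡ 1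
  sum-unitVector {suc m} Fin.zero    = cong suc (sum-replicate-0 m)
  sum-unitVector {suc m} (Fin.suc i) = sum-unitVector i

  positive-+ : ∀ a b → positive (a + b) ≡ positive a ∨ positive b
  positive-+ zero    b = refl
  positive-+ (suc a) b = refl

  support-zipWith-+ : (u v : Vec ℕ m) →
                      support (Vec.zipWith _+_ u v) ≡ support u ∪ support v
  support-zipWith-+ []      []      = refl
  support-zipWith-+ (x ∷ u) (y ∷ v) =
    cong₂ _∷_ (positive-+ x y) (support-zipWith-+ u v)

  support-nonempty : (u : Vec ℕ m) → Vec.sum u ≢ 0 → Nonempty (support u)
  support-nonempty []          sum≢0 = ⊥-elim (sum≢0 refl)
  support-nonempty (suc _ ∷ u) _     = Fin.zero , Vec.here
  support-nonempty (zero ∷ u)  sum≢0 with support-nonempty u sum≢0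
  ... | i , i∈u = Fin.suc i , Vec.there i∈u

open ExponentVector

module Linearization {c ℓ : Level} (F : Field c ℓ) (n : ℕ) where
  open Field F
  open PC F n
  open import Algebra.Properties.CommutativeSemigroup +-commutativeSemigroup
    using (x∙yz≈y∙xz)
  open import Algebra.Properties.Group +-group using (x∙y⁻¹≈ε⇒x≈y)
  open import Algebra.Properties.Ring ring using (-1*x≈-x)
  open import Relation.Binary.Reasoning.Setoid setoid

  Weight : Set c
  Weight = Monomial → Carrier

  evalWith : Weight → Poly → Carrier
  evalWith h []            = 0#
  evalWith h ((a , μ) ∷ t) = a * h μ + evalWith h t

  ≡⇒≈ : ∀ {x y} → x ≡ y → x ≈ y
  ≡⇒≈ ≡.refl = refl

  ≈P-sym : ∀ f g → f ≈P g → g ≈P f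
  ≈P-sym f g f≈g μ = sym (f≈g μ)

  ≈P-trans : ∀ f g k → f ≈P g → g ≈P k → f ≈P k
  ≈P-trans f g k f≈g g≈k μ = trans (f≈g μ) (g≈k μ)

  ≡⇒≈P : ∀ {f g} → f ≡ g → f ≈P g
  ≡⇒≈P ≡.refl μ = refl

  DegLe-cong : ∀ d f g → f ≈P g → DegLe d f → DegLe d g
  DegLe-cong d f g f≈g deg-f μ d<μ = trans (sym (f≈g μ)) (deg-f μ d<μ)

  coeff-∷-≡ : ∀ a μ t → coeff ((a , μ) ∷ t) μ ≡ a + coeff t μ
  coeff-∷-≡ a μ t with VecP.≡-dec ℕP._≟_ μ μ
  ... | yes _   = ≡.refl
  ... | no μ≢μ = ⊥-elim (μ≢μ ≡.refl)

  coeff-∷-≢ : ∀ a {ν μ} t → ν ≢ μ → coeff ((a , ν) ∷ t) μ ≡ coeff t μ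
  coeff-∷-≢ a {ν} {μ} t ν≢μ with VecP.≡-dec ℕP._≟_ ν μ
  ... | yes ν≡μ = ⊥-elim (ν≢μ ν≡μ)
  ... | no _    = ≡.refl

  coeff-++ : ∀ f g μ → coeff (f ++ g) μ ≈ coeff f μ + coeff g μ
  coeff-++ []            g μ = sym (+-identityˡ _)
  coeff-++ ((a , ν) ∷ t) g μ with VecP.≡-dec ℕP._≟_ ν μ
  ... | yes _ = trans (+-congˡ (coeff-++ t g μ)) (sym (+-assoc _ _ _))
  ... | no _  = coeff-++ t g μ

  coeff-scale : ∀ x g μ → coeff (scale x g) μ ≈ x * coeff g μ
  coeff-scale x []            μ = sym (zeroʳ x)
  coeff-scale x ((a , ν) ∷ t) μ with VecP.≡-dec ℕP._≟_ ν μ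
  ... | yes _ = trans (+-congˡ (coeff-scale x t μ)) (sym (distribˡ x _ _))
  ... | no _  = coeff-scale x t μ

  evalWith-++ : ∀ h f g → evalWith h (f ++ g) ≈ evalWith h f + evalWith h g
  evalWith-++ h []            g = sym (+-identityˡ _)
  evalWith-++ h ((a , μ) ∷ t) g =
    trans (+-congˡ (evalWith-++ h t g)) (sym (+-assoc _ _ _))

  evalWith-scale : ∀ h x g → evalWith h (scale x g) ≈ x * evalWith h g
  evalWith-scale h x []            = sym (zeroʳ x)
  evalWith-scale h x ((b , μ) ∷ t) =
    trans (+-cong (*-assoc x b (h μ)) (evalWith-scale h x t)) (sym (distribˡ x _ _))

  evalWith-lin : ∀ h a g b f →
                 evalWith h (lin a g b f) ≈ a * evalWith h g + b * evalWith h f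
  evalWith-lin h a g b f =
    trans (evalWith-++ h (scale a g) (scale b f))
          (+-cong (evalWith-scale h a g) (evalWith-scale h b f))

  evalWith-mulM : ∀ h ν f → evalWith h (mulM ν f) ≡ evalWith (λ κ → h (ν ·M κ)) f
  evalWith-mulM h ν []            = ≡.refl
  evalWith-mulM h ν ((a , μ) ∷ t) = ≡.cong (a * h (ν ·M μ) +_) (evalWith-mulM h ν t)

  evalWith-monoP : ∀ h μ → evalWith h (monoP μ) ≈ h μ
  evalWith-monoP h μ = trans (+-identityʳ _) (*-identityˡ (h μ))

  vanishAt : Monomial → Weight → Weight
  vanishAt ν h μ with VecP.≡-dec ℕP._≟_ μ ν
  ... | yes _ = 0#
  ... | no _  = h μ

  evalWith-vanishAt : ∀ h ν f →
                      evalWith h f ≈ coeff f ν * h ν + evalWith (vanishAt ν h) f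
  evalWith-vanishAt h ν [] = sym (trans (+-identityʳ _) (zeroˡ (h ν)))
  evalWith-vanishAt h ν ((a , κ) ∷ t) with VecP.≡-dec ℕP._≟_ κ ν
  ... | yes ≡.refl = begin
    a * h κ + evalWith h t
      ≈⟨ +-congˡ (evalWith-vanishAt h κ t) ⟩
    a * h κ + (coeff t κ * h κ + evalWith h′ t)
      ≈⟨ sym (+-assoc _ _ _) ⟩
    (a * h κ + coeff t κ * h κ) + evalWith h′ t
      ≈⟨ +-cong (sym (distribʳ (h κ) a _))
                (sym (trans (+-congʳ (zeroʳ a)) (+-identityˡ _))) ⟩
    (a + coeff t κ) * h κ + (a * 0# + evalWith h′ t) ∎
    where h′ = vanishAt κ h
  ... | no _ = trans (+-congˡ (evalWith-vanishAt h ν t)) (x∙yz≈y∙xz _ _ _)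

  -- Proved for every weight h at once, so that the induction may replace h
  -- by vanishAt ν h and thereby forget the cancelling occurrences of ν in t.
  evalWith-vanishes : ∀ h f → (∀ μ → coeff f μ * h μ ≈ 0#) → evalWith h f ≈ 0#
  evalWith-vanishes h []            _   = refl
  evalWith-vanishes h ((a , ν) ∷ t) f≈0 = begin
    a * h ν + evalWith h t
      ≈⟨ +-congˡ (evalWith-vanishAt h ν t) ⟩
    a * h ν + (coeff t ν * h ν + evalWith (vanishAt ν h) t)
      ≈⟨ sym (+-assoc _ _ _) ⟩
    (a * h ν + coeff t ν * h ν) + evalWith (vanishAt ν h) t
      ≈⟨ +-cong (sym (distribʳ (h ν) a _))
                (evalWith-vanishes (vanishAt ν h) t t≈0) ⟩
    (a + coeff t ν) * h ν + 0#
      ≈⟨ +-congʳ (trans (*-congʳ (≡⇒≈ (≡.sym (coeff-∷-≡ a ν t)))) (f≈0 ν)) ⟩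
    0# + 0#
      ≈⟨ +-identityˡ 0# ⟩
    0# ∎
    where
    t≈0 : ∀ μ → coeff t μ * vanishAt ν h μ ≈ 0#
    t≈0 μ with VecP.≡-dec ℕP._≟_ μ ν
    ... | yes _   = zeroʳ _
    ... | no μ≢ν =
      trans (*-congʳ (≡⇒≈ (≡.sym (coeff-∷-≢ a t (μ≢ν ∘ ≡.sym))))) (f≈0 μ)

  evalWith-cong : ∀ h f g → f ≈P g → evalWith h f ≈ evalWith h g
  evalWith-cong h f g f≈g = x∙y⁻¹≈ε⇒x≈y _ _ (begin
    evalWith h f - evalWith h g
      ≈⟨ +-congˡ (trans (sym (-1*x≈-x _)) (sym (evalWith-scale h (- 1#) g))) ⟩
    evalWith h f + evalWith h (scale (- 1#) g)
      ≈⟨ sym (evalWith-++ h f _) ⟩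
    evalWith h (f ++ scale (- 1#) g)
      ≈⟨ evalWith-vanishes h (f ++ scale (- 1#) g)
           (λ μ → trans (*-congʳ (difference≈0 μ)) (zeroˡ _)) ⟩
    0# ∎)
    where
    difference≈0 : ∀ μ → coeff (f ++ scale (- 1#) g) μ ≈ 0#
    difference≈0 μ = begin
      coeff (f ++ scale (- 1#) g) μ   ≈⟨ coeff-++ f _ μ ⟩
      coeff f μ + coeff (scale (- 1#) g) μ
        ≈⟨ +-cong (f≈g μ) (trans (coeff-scale (- 1#) g μ) (-1*x≈-x _)) ⟩
      coeff g μ - coeff g μ           ≈⟨ -‿inverseʳ _ ⟩
      0# ∎

  indicator : Monomial → Weight
  indicator μ ν with VecP.≡-dec ℕP._≟_ ν μ
  ... | yes _ = 1#
  ... | no _  = 0#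

  coeff≈evalWith-indicator : ∀ f μ → coeff f μ ≈ evalWith (indicator μ) f
  coeff≈evalWith-indicator []            μ = refl
  coeff≈evalWith-indicator ((a , ν) ∷ t) μ with VecP.≡-dec ℕP._≟_ ν μ
  ... | yes _ = +-cong (sym (*-identityʳ a)) (coeff≈evalWith-indicator t μ)
  ... | no _  = trans (coeff≈evalWith-indicator t μ)
                      (sym (trans (+-congʳ (zeroʳ a)) (+-identityˡ _)))

  mulM-cong : ∀ ν f g → f ≈P g → mulM ν f ≈P mulM ν g
  mulM-cong ν f g f≈g κ = begin
    coeff (mulM ν f) κ                      ≈⟨ coeff≈evalWith-indicator (mulM ν f) κ ⟩
    evalWith (indicator κ) (mulM ν f)       ≡⟨ evalWith-mulM (indicator κ) ν f ⟩
    evalWith (λ μ → indicator κ (ν ·M μ)) f ≈⟨ evalWith-cong _ f g f≈g ⟩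
    evalWith (λ μ → indicator κ (ν ·M μ)) g ≡⟨ evalWith-mulM (indicator κ) ν g ⟨
    evalWith (indicator κ) (mulM ν g)       ≈⟨ coeff≈evalWith-indicator (mulM ν g) κ ⟨
    coeff (mulM ν g) κ                      ∎

  mulM-oneM : ∀ f → mulM oneM f ≡ f
  mulM-oneM []            = ≡.refl
  mulM-oneM ((a , μ) ∷ t) =
    ≡.cong₂ _∷_ (≡.cong (a ,_) (VecP.zipWith-identityˡ ℕP.+-identityˡ μ)) (mulM-oneM t)

  mulM-mulM : ∀ ν μ f → mulM ν (mulM μ f) ≡ mulM (ν ·M μ) f
  mulM-mulM ν μ []            = ≡.refl
  mulM-mulM ν μ ((a , κ) ∷ t) =
    ≡.cong₂ _∷_ (≡.cong (a ,_) (≡.sym (VecP.zipWith-assoc ℕP.+-assoc ν μ κ)))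
                (mulM-mulM ν μ t)

  supp≡support : ∀ μ → supp μ ≡ support μ
  supp≡support = VecP.map-cong λ { zero → ≡.refl ; (suc _) → ≡.refl }

  supp-·M : ∀ ν μ → supp (ν ·M μ) ≡ supp ν ∪ supp μ
  supp-·M ν μ = ≡.trans (supp≡support (ν ·M μ)) (≡.trans (support-zipWith-+ ν μ)
                  (≡.sym (≡.cong₂ _∪_ (supp≡support ν) (supp≡support μ))))

  degM-·M-nonconstant : ∀ ν μ → degM μ ≢ 0 → degM (ν ·M μ) ≢ 0
  degM-·M-nonconstant ν μ μ≢0 νμ≡0 =
    μ≢0 (ℕP.m+n≡0⇒n≡0 (degM ν) (≡.trans (≡.sym (sum-zipWith-+ ν μ)) νμ≡0))

  degM-varM : ∀ i → degM (varM i) ≢ 0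
  degM-varM i x≡0 with ≡.trans (≡.sym (sum-unitVector i)) x≡0
  ... | ()

  evalM-constant : ∀ α μ → degM μ ≡ 0 → evalM α μ ≡ 1#
  evalM-constant α μ μ≡0 with degM μ
  evalM-constant α μ ≡.refl | .0 = ≡.refl

  evalM-nonconstant : ∀ α μ → degM μ ≢ 0 → evalM α μ ≡ α (supp μ)
  evalM-nonconstant α μ μ≢0 with degM μ
  ... | zero  = ⊥-elim (μ≢0 ≡.refl)
  ... | suc _ = ≡.refl

  evalM-·M-varM-idempotent : ∀ α ν i →
    evalM α (ν ·M (varM i ·M varM i)) ≡ evalM α (ν ·M varM i)
  evalM-·M-varM-idempotent α ν i = ≡.trans
    (evalM-nonconstant α _ (degM-·M-nonconstant ν _
      (degM-·M-nonconstant (varM i) (varM i) (degM-varM i))))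
    (≡.trans (≡.cong α supports)
      (≡.sym (evalM-nonconstant α _ (degM-·M-nonconstant ν _ (degM-varM i)))))
    where
    supports : supp (ν ·M (varM i ·M varM i)) ≡ supp (ν ·M varM i)
    supports = ≡.trans (supp-·M ν _) (≡.trans
      (≡.cong (supp ν ∪_) (≡.trans (supp-·M (varM i) (varM i)) (∪-idem _)))
      (≡.sym (supp-·M ν (varM i))))

  evalLin≡evalWith : ∀ α f → evalLin α f ≡ evalWith (evalM α) f
  evalLin≡evalWith α []            = ≡.refl
  evalLin≡evalWith α ((a , μ) ∷ t) = ≡.cong (a * evalM α μ +_) (evalLin≡evalWith α t)

  evalWith-oneP : ∀ α → evalWith (evalM α) oneP ≈ 1#
  evalWith-oneP α = trans (evalWith-monoP (evalM α) oneM)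
                          (≡⇒≈ (evalM-constant α oneM (sum-replicate-0 n)))

  boolAx-multiple-vanishes : ∀ α ν i → evalWith (evalM α) (mulM ν (boolAx i)) ≈ 0#
  boolAx-multiple-vanishes α ν i
    rewrite evalM-·M-varM-idempotent α ν i = begin
      1# * A + (- 1# * A + 0#)
        ≈⟨ +-cong (*-identityˡ A) (trans (+-identityʳ _) (-1*x≈-x A)) ⟩
      A - A
        ≈⟨ -‿inverseʳ A ⟩
      0# ∎
    where A = evalM α (ν ·M varM i)

  module Soundness {p : Level} (P : Poly → Set p) (d : ℕ) (α : Assignment)
                   (solves : SolvesMLIN P d α) (upward : ZeroUpwardClosed α) where

    L : Poly → Carrier
    L = evalWith (evalM α)

    evalM-zero-upward : ∀ ν μ → evalM α μ ≈ 0# → evalM α (ν ·M μ) ≈ 0#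
    evalM-zero-upward ν μ μ≈0 with degM μ ℕP.≟ 0
    ... | yes μ≡0 =
      ⊥-elim (1≉0 (trans (≡⇒≈ (≡.sym (evalM-constant α μ μ≡0))) μ≈0))
    ... | no μ≢0  = begin
      evalM α (ν ·M μ)   ≡⟨ evalM-nonconstant α _ (degM-·M-nonconstant ν μ μ≢0) ⟩
      α (supp (ν ·M μ))  ≈⟨ upward (supp μ) _ nonempty supp⊆ α-supp≈0 ⟩
      0#                 ∎
      where
      α-supp≈0 : α (supp μ) ≈ 0#
      α-supp≈0 = trans (≡⇒≈ (≡.sym (evalM-nonconstant α μ μ≢0))) μ≈0
      nonempty : Nonempty (supp μ)
      nonempty = ≡.subst Nonempty (≡.sym (supp≡support μ)) (support-nonempty μ μ≢0)
      supp⊆ : supp μ ⊆ supp (ν ·M μ)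
      supp⊆ = ≡.subst (supp μ ⊆_) (≡.sym (supp-·M ν μ)) (q⊆p∪q (supp ν) (supp μ))

    axiom-multiple-vanishes : ∀ {a} g ν → Axiom P a → g ≈P mulM ν a → DegLe d g →
                              L g ≈ 0#
    axiom-multiple-vanishes g ν (fromP {f} f∈P) g≈νf deg-g = begin
      L g                  ≈⟨ evalWith-cong (evalM α) g (mulM ν f) g≈νf ⟩
      L (mulM ν f)         ≡⟨ evalLin≡evalWith α (mulM ν f) ⟨
      evalLin α (mulM ν f) ≈⟨ solves f ν f∈P (DegLe-cong d g (mulM ν f) g≈νf deg-g) ⟩
      0#                   ∎
    axiom-multiple-vanishes g ν (bool i) g≈νb _ =
      trans (evalWith-cong (evalM α) g (mulM ν (boolAx i)) g≈νb)
            (boolAx-multiple-vanishes α ν i)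

    derivable-vanishes : ∀ {f} → MonoDeriv P d f → L f ≈ 0#
    derivable-vanishes (axiom {f} ax deg-f) =
      axiom-multiple-vanishes f oneM ax (≡⇒≈P (≡.sym (mulM-oneM f))) deg-f
    derivable-vanishes (mult {f} i f-derivable (inj₁ (μ , f≈μ)) _) = begin
      L (mulVar i f)          ≈⟨ evalWith-cong (evalM α) (mulVar i f) (monoP (varM i ·M μ))
                                   (mulM-cong (varM i) f (monoP μ) f≈μ) ⟩
      L (monoP (varM i ·M μ)) ≈⟨ evalWith-monoP (evalM α) (varM i ·M μ) ⟩
      evalM α (varM i ·M μ)   ≈⟨ evalM-zero-upward (varM i) μ μ≈0 ⟩
      0#                      ∎
      where
      μ≈0 : evalM α μ ≈ 0#
      μ≈0 = begin
        evalM α μ     ≈⟨ evalWith-monoP (evalM α) μ ⟨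
        L (monoP μ)   ≈⟨ evalWith-cong (evalM α) (monoP μ) f (≈P-sym f (monoP μ) f≈μ) ⟩
        L f           ≈⟨ derivable-vanishes f-derivable ⟩
        0#            ∎
    derivable-vanishes (mult {f} i _ (inj₂ (μ , a , ax , f≈μa)) deg) =
      axiom-multiple-vanishes (mulVar i f) (varM i ·M μ) ax
        (≈P-trans (mulVar i f) (mulM (varM i) (mulM μ a)) (mulM (varM i ·M μ) a)
          (mulM-cong (varM i) f (mulM μ a) f≈μa) (≡⇒≈P (mulM-mulM (varM i) μ a))) deg
    derivable-vanishes (lincomb {g} {f} a b g-derivable f-derivable _) = begin
      L (lin a g b f)     ≈⟨ evalWith-lin _ a g b f ⟩
      a * L g + b * L f   ≈⟨ +-cong (*-congˡ (derivable-vanishes g-derivable))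
                                    (*-congˡ (derivable-vanishes f-derivable)) ⟩
      a * 0# + b * 0#     ≈⟨ +-cong (zeroʳ a) (zeroʳ b) ⟩
      0# + 0#             ≈⟨ +-identityˡ 0# ⟩
      0#                  ∎

lemma3 : {c ℓ p : Level} (F : Field c ℓ) (n : ℕ) (P : PC.Poly F n → Set p) (d : ℕ)
         (α : PC.Assignment F n) →
         PC.SolvesMLIN F n P d α → PC.ZeroUpwardClosed F n α →
         ¬ PC.MonoRefutation F n P d
lemma3 F n P d α solves upward (f , f-derivable , f≈1) = 1≉0 (begin
  1#     ≈⟨ evalWith-oneP α ⟨
  L oneP ≈⟨ evalWith-cong (evalM α) oneP f (≈P-sym f oneP f≈1) ⟩
  L f    ≈⟨ derivable-vanishes f-derivable ⟩
  0#     ∎)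
  where
  open Field F
  open PC F n
  open Linearization F n
  open Soundness P d α solves upward
  open import Relation.Binary.Reasoning.Setoid setoid
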